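{- Let $G=(V,E)$ be a finite simple undirected graph. For an integer $k$, let $core(k)$ denote the set of vertices of $G$ whose core number is exactly $k$, and let $outcore(k)$ be the set of (undirected) edges $\{u,v\}\in E$ with $u\in core(k)$ and $v\in\bigcup_{i\ge k}core(i)$. Then $|outcore(k)|\le k\cdot|core(k)|$.
   Context: A $k$-core of $G$ is a maximal connected induced subgraph in which every vertex has degree at least $k$; the core number of a vertex $v$ is the largest $k$ such that $v$ lies in a $k$-core. -}

module Defs where

open import Data.Nat using (ℕ; zero; suc; _+_; _*_; _≤_; _≡ᵇ_; _≤ᵇ_; _<ᵇ_)
open import Data.Fin using (Fin; toℕ) renaming (zero to fzero; suc to fsuc)
open import Data.Bool using (Bool; true; false; _∧_; _∨_; if_then_else_)
open import Data.Product using (Σ; ∃; _×_)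
open import Relation.Binary.PropositionalEquality using (_≡_)

record Graph (n : ℕ) : Set where
  field
    adj    : Fin n → Fin n → Bool
    sym    : ∀ u v → adj u v ≡ adj v u
    irrefl : ∀ v → adj v v ≡ false
open Graph public

countFin : ∀ {n} → (Fin n → Bool) → ℕ
countFin {zero}  f = 0
countFin {suc n} f = (if f fzero then 1 else 0) + countFin (λ i → f (fsuc i))

sumFin : ∀ {n} → (Fin n → ℕ) → ℕ
sumFin {zero}  f = 0
sumFin {suc n} f = f fzero + sumFin (λ i → f (fsuc i))

VSet : ℕ → Set
VSet n = Fin n → Bool

_⊆_ : ∀ {n} → VSet n → VSet n → Set
S ⊆ T = ∀ v → S v ≡ true → T v ≡ true

module _ {n : ℕ} (G : Graph n) where

  degIn : VSet n → Fin n → ℕ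
  degIn S v = countFin (λ u → S u ∧ adj G v u)

  MinDeg : VSet n → ℕ → Set
  MinDeg S k = ∀ v → S v ≡ true → k ≤ degIn S v

  data Reach (S : VSet n) : Fin n → Fin n → Set where
    here : ∀ {u} → Reach S u u
    step : ∀ {u w v} → adj G u w ≡ true → S w ≡ true → Reach S w v → Reach S u v

  NonEmpty : VSet n → Set
  NonEmpty S = ∃ λ v → S v ≡ true

  Connected : VSet n → Set
  Connected S = NonEmpty S × (∀ u v → S u ≡ true → S v ≡ true → Reach S u v)

  IsKCore : ℕ → VSet n → Set
  IsKCore k S = Connected S × MinDeg S k
              × (∀ T → S ⊆ T → Connected T → MinDeg T k → T ⊆ S)

  InKCore : ℕ → Fin n → Set
  InKCore k v = ∃ λ S → IsKCore k S × (S v ≡ true)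

  IsCoreNumber : Fin n → ℕ → Set
  IsCoreNumber v k = InKCore k v × (∀ j → InKCore j v → j ≤ k)

  coreSize : (Fin n → ℕ) → ℕ → ℕ
  coreSize cn k = countFin (λ v → cn v ≡ᵇ k)

  -- |outcore(k)|: undirected edges {u,v} (counted once, as u < v) with one
  -- endpoint of core number exactly k and the other of core number ≥ k
  inOut : (Fin n → ℕ) → ℕ → Fin n → Fin n → Bool
  inOut cn k u v = ((cn u ≡ᵇ k) ∧ (k ≤ᵇ cn v)) ∨ ((cn v ≡ᵇ k) ∧ (k ≤ᵇ cn u))

  outcoreSize : (Fin n → ℕ) → ℕ → ℕ
  outcoreSize cn k =
    sumFin (λ u → countFin (λ v → (toℕ u <ᵇ toℕ v) ∧ adj G u v ∧ inOut cn k u v))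

module Submission where

-- Let D be the set of vertices of core number greater than k. The edges of outcore(k) are
-- the edges of G[core(k) ∪ D] with an endpoint in core(k). Every nonempty T ⊆ core(k) has a
-- vertex of degree at most k in G[T ∪ D]: otherwise T ∪ D has minimum degree k + 1 (a vertex
-- of D keeps the neighbours of its own core, which all lie in D), so the component of a vertex
-- of T extends to a (k+1)-core, contradicting its core number k. Removing such vertices one at
-- a time loses at most k of the counted edges each time. Components and maximal extensions
-- are only obtained classically; the inequality is decidable, so this is harmless.

open import Defs hiding (sym)
open import Data.Bool.Base using (Bool; true; false; _∧_; _∨_; not; if_then_else_)
open import Data.Bool.Properties using (∧-zeroʳ; ∧-comm; ∨-comm; ∨-zeroʳ; T-≡)
open import Data.Fin.Base using (Fin; toℕ) renaming (zero to fzero; suc to fsuc)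
open import Data.Fin.Properties using (_≟_)
open import Data.Nat.Base using (ℕ; zero; suc; _+_; _*_; _≤_; _<_; _≡ᵇ_; _≤ᵇ_; _<ᵇ_; z≤n; s≤s)
open import Data.Nat.Properties
  using (≤-refl; ≤-reflexive; ≤-trans; _≤?_; <-irrefl; ≰⇒>; <⇒≱; m≤m+n; +-identityʳ; +-suc; *-zeroʳ;
         *-suc; suc-injective; +-mono-≤; +-monoˡ-≤; +-monoʳ-≤; +-mono-≤-<; ≡ᵇ⇒≡; <ᵇ⇒<; ≤⇒≤ᵇ;
         +-commutativeSemigroup; module ≤-Reasoning)
open import Algebra.Properties.CommutativeSemigroup +-commutativeSemigroup using (interchange)
open import Data.Product.Base using (∃; _×_; _,_; proj₁; proj₂)
open import Effect.Monad using (RawMonad)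
open import Function.Base using (id; _∘_)
open import Function.Bundles using (Equivalence)
open import Level using (0ℓ)
open import Relation.Binary.PropositionalEquality using (_≡_; refl; sym; trans; cong; cong₂)
open import Relation.Nullary.Decidable
  using (Dec; yes; no; does; dec-true; decidable-stable; ¬¬-excluded-middle)
open import Relation.Nullary.Negation using (¬_; ¬¬-Monad; ¬¬-map; contradiction)

open RawMonad (¬¬-Monad {a = 0ℓ})

-- Written exactly as the summand of countFin, so that countFin f unfolds to ⟦ f fzero ⟧ + ⋯.
⟦_⟧ : Bool → ℕ
⟦ b ⟧ = if b then 1 else 0

⟦⟧-mono : ∀ {a b} → (a ≡ true → b ≡ true) → ⟦ a ⟧ ≤ ⟦ b ⟧
⟦⟧-mono {false} _   = z≤n
⟦⟧-mono {true}  a⇒b rewrite a⇒b refl = ≤-refl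

⟦⟧≤1 : ∀ b → ⟦ b ⟧ ≤ 1
⟦⟧≤1 false = z≤n
⟦⟧≤1 true  = ≤-refl

∧-elimʳ : ∀ a {b} → a ∧ b ≡ true → b ≡ true
∧-elimʳ true b≡true = b≡true

∧-monoʳ : ∀ a {b c} → (b ≡ true → c ≡ true) → a ∧ b ≡ true → a ∧ c ≡ true
∧-monoʳ true b⇒c = b⇒c

∧-monoˡ : ∀ {a b} c → (a ≡ true → b ≡ true) → a ∧ c ≡ true → b ∧ c ≡ true
∧-monoˡ {true} c a⇒b ac rewrite a⇒b refl = ac

⟦⟧-disjoint : ∀ a b x → a ∧ b ≡ false → ⟦ a ∧ x ⟧ + ⟦ b ∧ x ⟧ ≤ ⟦ x ⟧
⟦⟧-disjoint true  true  _ ()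
⟦⟧-disjoint true  false x _ = ≤-reflexive (+-identityʳ ⟦ x ⟧)
⟦⟧-disjoint false b     x _ = ⟦⟧-mono (∧-elimʳ b)

<ᵇ-asym : ∀ m n → (m <ᵇ n) ∧ (n <ᵇ m) ≡ false
<ᵇ-asym zero    zero    = refl
<ᵇ-asym zero    (suc n) = refl
<ᵇ-asym (suc m) zero    = refl
<ᵇ-asym (suc m) (suc n) = <ᵇ-asym m n

≤ᵇ-split : ∀ k x → (k ≤ᵇ x) ≡ (x ≡ᵇ k) ∨ (k <ᵇ x)
≤ᵇ-split zero    zero    = refl
≤ᵇ-split zero    (suc x) = refl
≤ᵇ-split (suc k) zero    = refl
≤ᵇ-split (suc k) (suc x) = trans (<ᵇ-suc k) (≤ᵇ-split k x)
  where
  <ᵇ-suc : ∀ k → (k <ᵇ suc x) ≡ (k ≤ᵇ x)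
  <ᵇ-suc zero    = refl
  <ᵇ-suc (suc k) = refl

-- Sums and counts over Fin

sumFin-cong : ∀ {n} {f g : Fin n → ℕ} → (∀ i → f i ≡ g i) → sumFin f ≡ sumFin g
sumFin-cong {zero}  _   = refl
sumFin-cong {suc n} f≗g = cong₂ _+_ (f≗g fzero) (sumFin-cong (f≗g ∘ fsuc))

sumFin-mono : ∀ {n} {f g : Fin n → ℕ} → (∀ i → f i ≤ g i) → sumFin f ≤ sumFin g
sumFin-mono {zero}  _   = z≤n
sumFin-mono {suc n} f≤g = +-mono-≤ (f≤g fzero) (sumFin-mono (f≤g ∘ fsuc))

sumFin-+ : ∀ {n} (f g : Fin n → ℕ) → sumFin (λ i → f i + g i) ≡ sumFin f + sumFin g
sumFin-+ {zero}  f g = refl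
sumFin-+ {suc n} f g =
  trans (cong (f fzero + g fzero +_) (sumFin-+ (f ∘ fsuc) (g ∘ fsuc)))
        (interchange (f fzero) (g fzero) (sumFin (f ∘ fsuc)) (sumFin (g ∘ fsuc)))

sumFin-zero : ∀ {n} → sumFin {n} (λ _ → 0) ≡ 0
sumFin-zero {zero}  = refl
sumFin-zero {suc n} = sumFin-zero {n}

sumFin-if : ∀ {n} b (f : Fin n → ℕ)
          → sumFin (λ i → if b then f i else 0) ≡ (if b then sumFin f else 0)
sumFin-if     true  f = refl
sumFin-if {n} false f = sumFin-zero {n}

sumFin-δ : ∀ {n} (s : Fin n) x → sumFin (λ i → if does (i ≟ s) then x else 0) ≡ x
sumFin-δ {suc n} fzero    x = trans (cong (x +_) (sumFin-zero {n})) (+-identityʳ x)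
sumFin-δ {suc n} (fsuc s) x = sumFin-δ s x

countFin≡sumFin : ∀ {n} (f : Fin n → Bool) → countFin f ≡ sumFin (λ i → ⟦ f i ⟧)
countFin≡sumFin {zero}  f = refl
countFin≡sumFin {suc n} f = cong (⟦ f fzero ⟧ +_) (countFin≡sumFin (f ∘ fsuc))

countFin-cong : ∀ {n} {f g : Fin n → Bool} → (∀ i → f i ≡ g i) → countFin f ≡ countFin g
countFin-cong {zero}  _   = refl
countFin-cong {suc n} f≗g = cong₂ _+_ (cong ⟦_⟧ (f≗g fzero)) (countFin-cong (f≗g ∘ fsuc))

countFin-mono : ∀ {n} {f g : Fin n → Bool}
              → (∀ i → f i ≡ true → g i ≡ true) → countFin f ≤ countFin g
countFin-mono {zero}  _   = z≤n
countFin-mono {suc n} f⊆g = +-mono-≤ (⟦⟧-mono (f⊆g fzero)) (countFin-mono (f⊆g ∘ fsuc))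

countFin-≤ : ∀ {n} (f : Fin n → Bool) → countFin f ≤ n
countFin-≤ {zero}  f = z≤n
countFin-≤ {suc n} f = +-mono-≤ (⟦⟧≤1 (f fzero)) (countFin-≤ (f ∘ fsuc))

countFin-< : ∀ {n} {f g : Fin n → Bool} → (∀ i → f i ≡ true → g i ≡ true)
           → ∀ v → g v ≡ true → f v ≡ false → countFin f < countFin g
countFin-< {suc n} f⊆g fzero gv fv rewrite gv | fv = s≤s (countFin-mono (f⊆g ∘ fsuc))
countFin-< {suc n} f⊆g (fsuc v) gv fv =
  +-mono-≤-< (⟦⟧-mono (f⊆g fzero)) (countFin-< (f⊆g ∘ fsuc) v gv fv)

countFin-≡0 : ∀ {n} (f : Fin n → Bool) → countFin f ≡ 0 → ∀ i → f i ≡ false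
countFin-≡0 {suc n} f |f|≡0 i with f fzero in f₀
countFin-≡0 {suc n} f () i | true
countFin-≡0 {suc n} f |f|≡0 fzero    | false = f₀
countFin-≡0 {suc n} f |f|≡0 (fsuc i) | false = countFin-≡0 (f ∘ fsuc) |f|≡0 i

countFin-false : ∀ {n} (f : Fin n → Bool) → (∀ i → f i ≡ false) → countFin f ≡ 0
countFin-false {zero}  f _      = refl
countFin-false {suc n} f f≡false rewrite f≡false fzero =
  countFin-false (f ∘ fsuc) (f≡false ∘ fsuc)

countFin-suc : ∀ {n m} (f : Fin n → Bool) → countFin f ≡ suc m → ∃ λ i → f i ≡ true
countFin-suc {suc n} f |f|≡1+m with f fzero in f₀
... | true  = fzero , f₀
... | false = let i , fi = countFin-suc (f ∘ fsuc) |f|≡1+m in fsuc i , fi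

_∪_ : ∀ {n} → VSet n → VSet n → VSet n
(S ∪ T) v = S v ∨ T v

_─_ : ∀ {n} → VSet n → Fin n → VSet n
(S ─ s) v = not (does (v ≟ s)) ∧ S v

∪-introʳ : ∀ {n} (S T : VSet n) v → T v ≡ true → (S ∪ T) v ≡ true
∪-introʳ S T v Tv rewrite Tv = ∨-zeroʳ (S v)

countFin-─ : ∀ {n} (S : VSet n) {s} → S s ≡ true → countFin S ≡ suc (countFin (S ─ s))
countFin-─ {suc n} S {fzero}  Ss rewrite Ss = refl
countFin-─ {suc n} S {fsuc s} Ss =
  trans (cong (⟦ S fzero ⟧ +_) (countFin-─ (S ∘ fsuc) Ss)) (+-suc ⟦ S fzero ⟧ _)

between : ∀ {n} → VSet n → VSet n → Fin n → Fin n → Bool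
between S T u v = (S u ∧ T v) ∨ (S v ∧ T u)

between-∪ʳ : ∀ {n} (S D : VSet n) u v → between S (S ∪ D) u v ≡ true → (S ∪ D) v ≡ true
between-∪ʳ S D u v = lemma (S u) (S v) (D u) (D v)
  where
  lemma : ∀ a b c d → (a ∧ (b ∨ d)) ∨ (b ∧ (a ∨ c)) ≡ true → b ∨ d ≡ true
  lemma _     true  _ _     _  = refl
  lemma true  false _ true  _  = refl
  lemma true  false _ false ()
  lemma false false _ _     ()

between-∪ˡ : ∀ {n} (S D : VSet n) u v → between S (S ∪ D) u v ≡ true → (S ∪ D) u ≡ true
between-∪ˡ S D u v uv = between-∪ʳ S D v u (trans (∨-comm (S v ∧ _) (S u ∧ _)) uv)

-- Components and k-cores

¬¬-∀Fin : ∀ {n} {P : Fin n → Set} → (∀ i → ¬ ¬ P i) → ¬ ¬ (∀ i → P i)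
¬¬-∀Fin {zero}  _   = pure λ ()
¬¬-∀Fin {suc n} ¬¬P = do
  p₀ ← ¬¬P fzero
  ps ← ¬¬-∀Fin (¬¬P ∘ fsuc)
  pure λ where
    fzero    → p₀
    (fsuc i) → ps i

module _ {n : ℕ} (G : Graph n) where

  reach-++ : ∀ {S u w v} → Reach G S u w → Reach G S w v → Reach G S u v
  reach-++ here           q = q
  reach-++ (step uw Sw p) q = step uw Sw (reach-++ p q)

  reach-∈ : ∀ {S u v} → S u ≡ true → Reach G S u v → S v ≡ true
  reach-∈ Su here           = Su
  reach-∈ _  (step _ Sw p)  = reach-∈ Sw p

  reach-sym : ∀ {S u v} → S u ≡ true → Reach G S u v → Reach G S v u
  reach-sym Su here = here
  reach-sym {u = u} Su (step {w = w} uw Sw p) =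
    reach-++ (reach-sym Sw p) (step (trans (Graph.sym G w u) uw) Su here)

  degIn-mono : ∀ {S T} → S ⊆ T → ∀ v → degIn G S v ≤ degIn G T v
  degIn-mono S⊆T v = countFin-mono λ u → ∧-monoˡ (adj G v u) (S⊆T u)

  module Component {T : VSet n} {s : Fin n} (Ts : T s ≡ true)
                   (reach? : ∀ v → Dec (Reach G T s v)) where

    C : VSet n
    C v = does (reach? v)

    reach⇒∈C : ∀ {v} → Reach G T s v → C v ≡ true
    reach⇒∈C {v} = dec-true (reach? v)

    ∈C⇒reach : ∀ {v} → C v ≡ true → Reach G T s v
    ∈C⇒reach {v} Cv with reach? v
    ... | yes r = r

    C⊆T : C ⊆ T
    C⊆T v = reach-∈ Ts ∘ ∈C⇒reach

    reach-within-C : ∀ {x v} → Reach G T s x → Reach G T x v → Reach G C x v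
    reach-within-C _  here            = here
    reach-within-C sx (step xw Tw wv) =
      let sw = reach-++ sx (step xw Tw here) in step xw (reach⇒∈C sw) (reach-within-C sw wv)

    connected : Connected G C
    connected = (s , reach⇒∈C here) , λ u v Cu Cv →
      reach-++ (reach-sym (reach⇒∈C here) (reach-within-C here (∈C⇒reach Cu)))
               (reach-within-C here (∈C⇒reach Cv))

    minDeg : ∀ {j} → MinDeg G T j → MinDeg G C j
    minDeg mT v Cv = ≤-trans (mT v (C⊆T v Cv)) (countFin-mono neighbour)
      where
      neighbour : ∀ u → (T u ∧ adj G v u) ≡ true → (C u ∧ adj G v u) ≡ true
      neighbour u _ with T u in Tu | adj G v u in vu
      ... | true | true rewrite reach⇒∈C (reach-++ (∈C⇒reach Cv) (step vu Tu here)) = refl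

  ProperlyExtendable : ℕ → VSet n → Set
  ProperlyExtendable j W =
    ∃ λ T → W ⊆ T × Connected G T × MinDeg G T j × ∃ λ v → T v ≡ true × W v ≡ false

  extend-to-kCore : ∀ j m W → n ≤ m + countFin W → Connected G W → MinDeg G W j
                  → ¬ ¬ (∃ λ K → IsKCore G j K × W ⊆ K)
  extend-to-kCore j m W room cW mW = ¬¬-excluded-middle >>= λ where
      (no ¬extendable) → pure (W , (cW , mW , maximal ¬extendable) , λ _ → id)
      (yes (T , W⊆T , cT , mT , v , Tv , Wv)) →
        extend-further m room T W⊆T cT mT (countFin-< W⊆T v Tv Wv)
    where
    maximal : ¬ ProperlyExtendable j W → ∀ T → W ⊆ T → Connected G T → MinDeg G T j → T ⊆ W
    maximal ¬extendable T W⊆T cT mT v Tv with W v in Wv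
    ... | true  = refl
    ... | false = contradiction (T , W⊆T , cT , mT , v , Tv , Wv) ¬extendable

    extend-further : ∀ m → n ≤ m + countFin W → ∀ T → W ⊆ T → Connected G T → MinDeg G T j
                   → countFin W < countFin T → ¬ ¬ (∃ λ K → IsKCore G j K × W ⊆ K)
    extend-further zero room T _ _ _ |W|<|T| =
      contradiction (≤-trans (countFin-≤ T) room) (<⇒≱ |W|<|T|)
    extend-further (suc m) room T W⊆T cT mT |W|<|T| =
      ¬¬-map (λ (K , isK , T⊆K) → K , isK , λ v → T⊆K v ∘ W⊆T v)
             (extend-to-kCore j m T room′ cT mT)
      where
      room′ : n ≤ m + countFin T
      room′ = ≤-trans room
                (≤-trans (≤-reflexive (sym (+-suc m (countFin W)))) (+-monoʳ-≤ m |W|<|T|))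

  minDeg⇒inKCore : ∀ {j T s} → MinDeg G T j → T s ≡ true → ¬ ¬ InKCore G j s
  minDeg⇒inKCore {j} {T} {s} mT Ts = do
    reach? ← ¬¬-∀Fin (λ v → ¬¬-excluded-middle)
    let open Component {T} {s} Ts reach?
    (K , isK , C⊆K) ← extend-to-kCore j n C (m≤m+n n (countFin C)) connected (minDeg mT)
    pure (K , isK , C⊆K s (reach⇒∈C here))

-- Edges touching a vertex set

module _ {n : ℕ} (G : Graph n) where

  edgesWith : (Fin n → Fin n → Bool) → ℕ
  edgesWith P = sumFin (λ u → countFin (λ v → (toℕ u <ᵇ toℕ v) ∧ adj G u v ∧ P u v))

  edgesWith-cong : ∀ {P Q} → (∀ u v → P u v ≡ Q u v) → edgesWith P ≡ edgesWith Q
  edgesWith-cong P≗Q = sumFin-cong λ u → countFin-cong λ v →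
    cong ((toℕ u <ᵇ toℕ v) ∧_) (cong (adj G u v ∧_) (P≗Q u v))

  module _ (D : VSet n) where

    edgesTouching : VSet n → ℕ
    edgesTouching S = edgesWith (between S (S ∪ D))

    private
      edge edgeInto edgeFrom : VSet n → Fin n → Fin n → Bool
      edge     S u v = (toℕ u <ᵇ toℕ v) ∧ adj G u v ∧ between S (S ∪ D) u v
      edgeInto S u v = (toℕ u <ᵇ toℕ v) ∧ adj G u v ∧ (S ∪ D) v
      edgeFrom S u v = (toℕ u <ᵇ toℕ v) ∧ adj G u v ∧ (S ∪ D) u

      -- An edge counted for S but not for S ─ s joins s to a vertex of S ∪ D.
      edge-─ : ∀ S s u v →
        ⟦ edge S u v ⟧ ≤ (if does (u ≟ s) then ⟦ edgeInto S s v ⟧ else 0)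
                         + (if does (v ≟ s) then ⟦ edgeFrom S u s ⟧ else 0)
                         + ⟦ edge (S ─ s) u v ⟧
      edge-─ S s u v with u ≟ s | v ≟ s
      ... | yes refl | _ =
        ≤-trans (⟦⟧-mono (∧-monoʳ (toℕ s <ᵇ toℕ v) (∧-monoʳ (adj G s v) (between-∪ʳ S D s v))))
                (≤-trans (m≤m+n _ _) (m≤m+n _ _))
      ... | no _ | yes refl =
        ≤-trans (⟦⟧-mono (∧-monoʳ (toℕ u <ᵇ toℕ s) (∧-monoʳ (adj G u s) (between-∪ˡ S D u s))))
                (m≤m+n _ _)
      ... | no _ | no _ = ≤-refl

      edgeInto+edgeFrom≤ : ∀ S s v
                         → ⟦ edgeInto S s v ⟧ + ⟦ edgeFrom S v s ⟧ ≤ ⟦ (S ∪ D) v ∧ adj G s v ⟧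
      edgeInto+edgeFrom≤ S s v rewrite Graph.sym G v s =
        ≤-trans (⟦⟧-disjoint (toℕ s <ᵇ toℕ v) (toℕ v <ᵇ toℕ s) _ (<ᵇ-asym (toℕ s) (toℕ v)))
                (≤-reflexive (cong ⟦_⟧ (∧-comm (adj G s v) ((S ∪ D) v))))

    edgesTouching-─ : ∀ S s → edgesTouching S ≤ degIn G (S ∪ D) s + edgesTouching (S ─ s)
    edgesTouching-─ S s = begin
      edgesTouching S
        ≡⟨ sumFin-cong (λ u → countFin≡sumFin (edge S u)) ⟩
      sumFin (λ u → sumFin (λ v → ⟦ edge S u v ⟧))
        ≤⟨ sumFin-mono (λ u → sumFin-mono (edge-─ S s u)) ⟩
      sumFin (λ u → sumFin (λ v → into u v + from u v + ⟦ edge (S ─ s) u v ⟧))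
        ≡⟨ sumFin-cong sum-over-v ⟩
      sumFin (λ u → intoAt u + outward u + edgesAt u)
        ≡⟨ sum-over-u ⟩
      sumFin inward + sumFin outward + edgesTouching (S ─ s)
        ≤⟨ +-monoˡ-≤ (edgesTouching (S ─ s)) degree-bound ⟩
      degIn G (S ∪ D) s + edgesTouching (S ─ s) ∎
      where
      open ≤-Reasoning
      inward outward intoAt edgesAt : Fin n → ℕ
      inward  v = ⟦ edgeInto S s v ⟧
      intoAt  u = if does (u ≟ s) then sumFin inward else 0
      outward u = ⟦ edgeFrom S u s ⟧
      edgesAt u = countFin (edge (S ─ s) u)
      into from : Fin n → Fin n → ℕ
      into u v = if does (u ≟ s) then inward v else 0
      from u v = if does (v ≟ s) then outward u else 0

      sum-over-v : ∀ u → sumFin (λ v → into u v + from u v + ⟦ edge (S ─ s) u v ⟧)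
                       ≡ intoAt u + outward u + edgesAt u
      sum-over-v u = begin-equality
        sumFin (λ v → into u v + from u v + ⟦ edge (S ─ s) u v ⟧)
          ≡⟨ sumFin-+ (λ v → into u v + from u v) (λ v → ⟦ edge (S ─ s) u v ⟧) ⟩
        sumFin (λ v → into u v + from u v) + sumFin (λ v → ⟦ edge (S ─ s) u v ⟧)
          ≡⟨ cong₂ _+_ (sumFin-+ (into u) (from u)) (sym (countFin≡sumFin (edge (S ─ s) u))) ⟩
        sumFin (into u) + sumFin (from u) + edgesAt u
          ≡⟨ cong (_+ edgesAt u)
                  (cong₂ _+_ (sumFin-if (does (u ≟ s)) inward) (sumFin-δ s (outward u))) ⟩
        intoAt u + outward u + edgesAt u ∎

      sum-over-u : sumFin (λ u → intoAt u + outward u + edgesAt u)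
                 ≡ sumFin inward + sumFin outward + edgesTouching (S ─ s)
      sum-over-u = begin-equality
        sumFin (λ u → intoAt u + outward u + edgesAt u)
          ≡⟨ sumFin-+ (λ u → intoAt u + outward u) edgesAt ⟩
        sumFin (λ u → intoAt u + outward u) + edgesTouching (S ─ s)
          ≡⟨ cong (_+ edgesTouching (S ─ s)) (sumFin-+ intoAt outward) ⟩
        sumFin intoAt + sumFin outward + edgesTouching (S ─ s)
          ≡⟨ cong (λ x → x + sumFin outward + edgesTouching (S ─ s)) (sumFin-δ s (sumFin inward)) ⟩
        sumFin inward + sumFin outward + edgesTouching (S ─ s) ∎

      degree-bound : sumFin inward + sumFin outward ≤ degIn G (S ∪ D) s
      degree-bound = begin
        sumFin inward + sumFin outward
          ≡⟨ sym (sumFin-+ inward outward) ⟩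
        sumFin (λ v → inward v + outward v)
          ≤⟨ sumFin-mono (edgeInto+edgeFrom≤ S s) ⟩
        sumFin (λ v → ⟦ (S ∪ D) v ∧ adj G s v ⟧)
          ≡⟨ sym (countFin≡sumFin (λ v → (S ∪ D) v ∧ adj G s v)) ⟩
        degIn G (S ∪ D) s ∎

    edgesTouching-∅ : ∀ S → (∀ v → S v ≡ false) → edgesTouching S ≡ 0
    edgesTouching-∅ S empty =
      trans (sumFin-cong (λ u → countFin-false (edge S u) (no-edge u))) (sumFin-zero {n})
      where
      no-edge : ∀ u v → edge S u v ≡ false
      no-edge u v rewrite empty u | empty v =
        trans (cong ((toℕ u <ᵇ toℕ v) ∧_) (∧-zeroʳ (adj G u v))) (∧-zeroʳ (toℕ u <ᵇ toℕ v))

    -- Only the double negation of a low-degree vertex is asked for: that is what the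
    -- core-number argument yields, and it suffices because the bound below is decidable.
    Degenerate : ℕ → VSet n → Set
    Degenerate k S = ∀ T → T ⊆ S → NonEmpty G T
                   → ¬ ¬ (∃ λ s → T s ≡ true × degIn G (T ∪ D) s ≤ k)

    degenerate⇒edgesTouching≤ : ∀ k S → Degenerate k S → edgesTouching S ≤ k * countFin S
    degenerate⇒edgesTouching≤ k S degenerate = peel (countFin S) S refl (λ _ → id)
      where
      peel : ∀ m T → countFin T ≡ m → T ⊆ S → edgesTouching T ≤ k * m
      peel zero T |T|≡0 _ =
        ≤-reflexive (trans (edgesTouching-∅ T (countFin-≡0 T |T|≡0)) (sym (*-zeroʳ k)))
      peel (suc m) T |T|≡1+m T⊆S = decidable-stable (_ ≤? _) λ ¬bound →
        degenerate T T⊆S (countFin-suc T |T|≡1+m) λ (s , Ts , deg≤k) → ¬bound (begin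
          edgesTouching T
            ≤⟨ edgesTouching-─ T s ⟩
          degIn G (T ∪ D) s + edgesTouching (T ─ s)
            ≤⟨ +-mono-≤ deg≤k (peel m (T ─ s) (|T─s| Ts) (T─s⊆S s)) ⟩
          k + k * m
            ≡⟨ sym (*-suc k m) ⟩
          k * suc m ∎)
        where
        open ≤-Reasoning
        |T─s| : ∀ {s} → T s ≡ true → countFin (T ─ s) ≡ m
        |T─s| Ts = suc-injective (trans (sym (countFin-─ T Ts)) |T|≡1+m)
        T─s⊆S : ∀ s → (T ─ s) ⊆ S
        T─s⊆S s v = T⊆S v ∘ ∧-elimʳ _

-- Core numbers

module _ {n : ℕ} (G : Graph n) {cn : Fin n → ℕ}
         (isCoreNumber : ∀ v → IsCoreNumber G v (cn v)) where

  kCore⇒≤coreNumber : ∀ {j K} → IsKCore G j K → ∀ w → K w ≡ true → j ≤ cn w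
  kCore⇒≤coreNumber {j} {K} isK w Kw = proj₂ (isCoreNumber w) j (K , isK , Kw)

  ≤coreNumber⇒≤degIn : ∀ {j v} → j ≤ cn v → j ≤ degIn G (λ w → j ≤ᵇ cn w) v
  ≤coreNumber⇒≤degIn {j} {v} j≤cnv with proj₁ (isCoreNumber v)
  ... | K , isK@(_ , minDegK , _) , Kv = begin
    j                              ≤⟨ j≤cnv ⟩
    cn v                           ≤⟨ minDegK v Kv ⟩
    degIn G K v                    ≤⟨ degIn-mono G K⊆ v ⟩
    degIn G (λ w → j ≤ᵇ cn w) v    ∎
    where
    open ≤-Reasoning
    K⊆ : K ⊆ (λ w → j ≤ᵇ cn w)
    K⊆ w Kw = Equivalence.to T-≡ (≤⇒≤ᵇ (≤-trans j≤cnv (kCore⇒≤coreNumber isK w Kw)))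

  coreLevel-degenerate : ∀ k → Degenerate G (λ v → k <ᵇ cn v) k (λ v → cn v ≡ᵇ k)
  coreLevel-degenerate k T T⊆core (s₀ , Ts₀) noLowDegree =
    minDeg⇒inKCore G minDeg T∪above-s₀ λ inKCore →
      <-irrefl (sym cn-s₀) (proj₂ (isCoreNumber s₀) (suc k) inKCore)
    where
    above : VSet n
    above v = k <ᵇ cn v
    cn-s₀ : cn s₀ ≡ k
    cn-s₀ = ≡ᵇ⇒≡ (cn s₀) k (Equivalence.from T-≡ (T⊆core s₀ Ts₀))
    T∪above-s₀ : (T ∪ above) s₀ ≡ true
    T∪above-s₀ rewrite Ts₀ = refl
    minDeg : MinDeg G (T ∪ above) (suc k)
    minDeg v _ with T v in Tv
    minDeg v _        | true  = ≰⇒> λ deg≤k → noLowDegree (v , Tv , deg≤k)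
    minDeg v above-v  | false =
      ≤-trans (≤coreNumber⇒≤degIn (<ᵇ⇒< k (cn v) (Equivalence.from T-≡ above-v)))
              (degIn-mono G (∪-introʳ T above) v)

lemma10 : ∀ {n} (G : Graph n) (cn : Fin n → ℕ)
        → (∀ v → IsCoreNumber G v (cn v))
        → ∀ (k : ℕ) → outcoreSize G cn k ≤ k * coreSize G cn k
lemma10 G cn isCoreNumber k = begin
  outcoreSize G cn k
    ≡⟨ edgesWith-cong G (λ u v → cong₂ (λ x y → ((cn u ≡ᵇ k) ∧ x) ∨ ((cn v ≡ᵇ k) ∧ y))
                                       (≤ᵇ-split k (cn v)) (≤ᵇ-split k (cn u))) ⟩
  edgesTouching G above core
    ≤⟨ degenerate⇒edgesTouching≤ G above k core (coreLevel-degenerate G isCoreNumber k) ⟩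
  k * coreSize G cn k ∎
  where
  open ≤-Reasoning
  core above : VSet _
  core v  = cn v ≡ᵇ k
  above v = k <ᵇ cn v
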